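{- Let $a,b$ be positive integers with $b\le 2a$, and let $T_{a,b}=\{C_{i,1}:1\le i\le 2a+1\}\cup\{C_{a+1,j}:2\le j\le b+1\}$, a $T$-shaped polyomino of size $n=2a+b+1$. Then on the $n\times n$ board, $$\mathrm{cp}_{\mathrm{fixed}}(T_{a,b})=\left\lceil \frac{2a+1}{2b+1}\right\rceil.$$
   Context: A cell $C_{i,j}$ ($i,j$ integers) is the closed unit square in column $i$ and row $j$ of the integer grid. A polyomino is a finite set of cells; its size is its number of cells. For a polyomino $\mathcal P$ of size $n$, the board is $\mathbb B=\{C_{i,j}:1\le i,j\le n\}$. A shift of $\mathcal P$ by an integer pair $(c,d)$ is $\{C_{x+c,y+d}:C_{x,y}\in\mathcal P\}$; two polyominoes are fixed equivalent if one is a shift of the other. A set of polyominoes is a valid arrangement if all lie in $\mathbb B$ and they are pairwise disjoint. A fixed packing of $\mathcal P$ is a valid arrangement of polyominoes fixed equivalent to $\mathcal P$ such that adding any further polyomino fixed equivalent to $\mathcal P$ yields an invalid arrangement. The clumsy fixed packing number $\mathrm{cp}_{\mathrm{fixed}}(\mathcal P)$ is the minimum number of polyominoes in a fixed packing of $\mathcal P$ on the $n\times n$ board, $n=|\mathcal P|$. -}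

module Defs where

open import Data.Nat as ℕ using (ℕ; suc; _+_; _*_; _∸_; _/_; NonZero)
open import Data.Integer as ℤ using (ℤ; +_)
open import Data.Product using (_×_; _,_; ∃)
open import Data.List using (List; []; _∷_; map; _++_; upTo; length)
open import Data.List.Membership.Propositional using (_∈_)
open import Data.List.Relation.Unary.All using (All)
open import Data.List.Relation.Unary.AllPairs using (AllPairs)
open import Relation.Nullary using (¬_)

-- A cell C_{i,j} is identified with its integer coordinates (column i, row j).
Cell : Set
Cell = ℤ × ℤ

-- A polyomino is a finite set of cells, represented by a duplicate-free list.
Polyomino : Set
Polyomino = List Cell

size : Polyomino → ℕ
size P = length P

shift : ℤ × ℤ → Polyomino → Polyomino
shift (c , d) P = map (λ { (x , y) → (x ℤ.+ c , y ℤ.+ d) }) P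

InBoard : ℕ → Cell → Set
InBoard n (x , y) = (+ 1 ℤ.≤ x × x ℤ.≤ + n) × (+ 1 ℤ.≤ y × y ℤ.≤ + n)

Disjoint : Polyomino → Polyomino → Set
Disjoint Q R = ∀ {c : Cell} → c ∈ Q → c ∈ R → ⊥'
  where open import Data.Empty renaming (⊥ to ⊥')

-- An arrangement of copies of P (polyominoes fixed equivalent to P) is
-- given by the list of shifts used.
ValidArrangement : ℕ → Polyomino → List (ℤ × ℤ) → Set
ValidArrangement n P L =
  All (λ s → All (InBoard n) (shift s P)) L ×
  AllPairs (λ s t → Disjoint (shift s P) (shift t P)) L

FixedPacking : Polyomino → List (ℤ × ℤ) → Set
FixedPacking P L =
  ValidArrangement (size P) P L ×
  (∀ (s : ℤ × ℤ) → ¬ ValidArrangement (size P) P (s ∷ L))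

IsClumsyFixedPackingNumber : Polyomino → ℕ → Set
IsClumsyFixedPackingNumber P k =
  (∃ λ L → FixedPacking P L × length L ≡ k) ×
  (∀ L → FixedPacking P L → k ℕ.≤ length L)
  where open import Relation.Binary.PropositionalEquality using (_≡_)

T : ℕ → ℕ → Polyomino
T a b = map (λ i → (+ suc i , + 1)) (upTo (suc (2 * a)))
     ++ map (λ j → (+ suc a , + (2 + j))) (upTo b)

⌈_/_⌉ : (m d : ℕ) .{{_ : NonZero d}} → ℕ
⌈ m / d ⌉ = (m + d ∸ 1) / d

{-# OPTIONS --safe #-}
module Submission where

open import Defs
open import Data.Nat using (ℕ; suc; _+_; _*_; _≤_; _<_)
open import Data.Nat as ℕ using (zero; z≤n; s≤s; s≤s⁻¹; z<s; _∸_; _⊓_; _/_; NonZero; _≤?_)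
open import Data.Nat.Properties
open import Data.Nat.DivMod
open import Data.Nat.Tactic.RingSolver using (solve-∀)
open import Data.Integer as ℤ using (ℤ; +_; -[1+_]; +≤+)
open import Data.Integer.Properties using (drop‿+≤+; +-injective)
open import Data.Product using (_×_; _,_; ∃; ∃₂; proj₁; proj₂; swap)
import Data.Product as Product
open import Data.Product.Properties using (,-injectiveʳ)
open import Data.Sum using (_⊎_; inj₁; inj₂)
import Data.Sum as Sum
open import Data.Empty using (⊥-elim)
open import Data.List using (List; []; _∷_; map; upTo; length; applyUpTo)
open import Data.List.Properties using (length-++; length-map; length-upTo; length-applyUpTo; length-removeAt′)
open import Data.List.Membership.Propositional using (_∈_; find)
open import Data.List.Membership.Propositional.Properties
open import Data.List.Relation.Unary.Any as Any using (Any; here; there; index; _─_)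
open import Data.List.Relation.Unary.Any.Properties using (¬Any[]) renaming (map⁺ to Any-map⁺)
open import Data.List.Relation.Unary.All as All using (All; _∷_)
open import Data.List.Relation.Unary.All.Properties using (¬Any⇒All¬)
open import Data.List.Relation.Unary.AllPairs using (_∷_)
open import Data.List.Relation.Unary.AllPairs.Properties using (applyUpTo⁺₁)
open import Relation.Binary.PropositionalEquality
open import Relation.Nullary using (¬_; Dec; yes; no; contradiction)
open import Relation.Nullary.Decidable using (_×-dec_)

-- Every copy of T_{a,b} in the board is the shift by some (x, y) with x ≤ b and y ≤ 2a.
-- Two copies whose columns differ by at most a meet exactly when their rows differ by at
-- most b, and since b ≤ 2a every column offset is within a of b ∸ a. Hence a packing is
-- maximal iff the row offsets of its copies b-cover {0, …, 2a}; as one offset covers at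
-- most 2b+1 values, at least ⌈(2a+1)/(2b+1)⌉ copies are needed, and the copies in
-- column b ∸ a at rows b, 3b+1, 5b+2, … (the last one truncated to 2a) achieve this.

Within : ℕ → ℕ → ℕ → Set
Within r x y = x ≤ y + r × y ≤ x + r

within? : ∀ r x y → Dec (Within r x y)
within? r x y = x ≤? y + r ×-dec y ≤? x + r

Within-sym : ∀ {r x y} → Within r x y → Within r y x
Within-sym = swap

Any-─ : ∀ {A : Set} {P : A → Set} {x} {xs : List A} (x∈xs : x ∈ xs) →
        Any P xs → P x ⊎ Any P (xs ─ x∈xs)
Any-─ (here refl) (here px)   = inj₁ px
Any-─ (here refl) (there pxs) = inj₂ pxs
Any-─ (there x∈xs) (here px)  = inj₂ (here px)
Any-─ (there x∈xs) (there pxs) = Sum.map₂ there (Any-─ x∈xs pxs)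

covering-bound : ∀ r (ys : List ℕ) m → (∀ i → i < m → Any (Within r i) ys) →
                 m ≤ length ys * suc (2 * r)
covering-bound r ys m = bound (length ys) ys refl m
  where
  d = suc (2 * r)

  bound : ∀ k ys → length ys ≡ k → ∀ m → (∀ i → i < m → Any (Within r i) ys) → m ≤ k * d
  bound k ys _ zero _ = z≤n
  bound zero [] _ (suc m) cov = ⊥-elim (¬Any[] (cov 0 z<s))
  bound (suc k) ys len m cov with ≤-total m d
  ... | inj₁ m≤d = ≤-trans m≤d (m≤m+n d (k * d))
  ... | inj₂ d≤m with m≤n⇒∃[o]m+o≡n d≤m
  ... | m′ , refl with find (cov (2 * r + m′) ≤-refl)
  ... | y , y∈ys , (top≤y+r , _) = +-monoʳ-≤ d (bound k (ys ─ y∈ys) len′ m′ cov′)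
    where
    len′ : length (ys ─ y∈ys) ≡ k
    len′ = suc-injective (trans (sym (length-removeAt′ ys (index y∈ys))) len)

    -- y covers the top index 2r + m′, so it covers no index below m′
    cov′ : ∀ i → i < m′ → Any (Within r i) (ys ─ y∈ys)
    cov′ i i<m′ with Any-─ y∈ys (cov i (<-≤-trans i<m′ (m≤n+m m′ d)))
    ... | inj₂ near = near
    ... | inj₁ (_ , y≤i+r) = contradiction m′≤i (<⇒≱ i<m′)
      where
      i+r+r≡2r+i : ∀ i r → i + r + r ≡ 2 * r + i
      i+r+r≡2r+i = solve-∀

      m′≤i : m′ ≤ i
      m′≤i = +-cancelˡ-≤ (2 * r) m′ i (≤-trans top≤y+r
               (≤-trans (+-monoˡ-≤ r y≤i+r) (≤-reflexive (i+r+r≡2r+i i r))))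

⌈1+m/d⌉≡1+⌊m/d⌋ : ∀ m d .{{_ : NonZero d}} → ⌈ suc m / d ⌉ ≡ suc (m / d)
⌈1+m/d⌉≡1+⌊m/d⌋ m d = trans (m/n≡1+[m∸n]/n (m≤n+m d m)) (cong (λ k → suc (k / d)) (m+n∸n≡m m d))

m<k*d⇒⌈1+m/d⌉≤k : ∀ {m k d} .{{_ : NonZero d}} → m < k * d → ⌈ suc m / d ⌉ ≤ k
m<k*d⇒⌈1+m/d⌉≤k {m} {k} {d} m<k*d =
  s≤s⁻¹ (m<n*o⇒m/o<n (subst (_< d + k * d) (+-comm d m) (+-monoʳ-< d m<k*d)))

row-offset-≤ : ∀ {r r′ y y′} b → r + y ≡ r′ + y′ → 1 ≤ r → r′ ≤ suc b → y ≤ y′ + b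
row-offset-≤ {r} {r′} {y} {y′} b eq 1≤r r′≤1+b = subst (y ≤_) (+-comm b y′)
  (s≤s⁻¹ (≤-trans (+-monoˡ-≤ y 1≤r) (subst (_≤ suc b + y′) (sym eq) (+-monoˡ-≤ y′ r′≤1+b))))

1≤1+i⇒ℕ : ∀ i → + 1 ℤ.≤ + 1 ℤ.+ i → ∃ λ n → i ≡ + n
1≤1+i⇒ℕ (+ n) _ = n , refl
1≤1+i⇒ℕ -[1+ zero ] (+≤+ ())
1≤1+i⇒ℕ -[1+ suc k ] ()

module _ (a b : ℕ) where

  Copy : ℕ → ℕ → Polyomino
  Copy x y = shift (+ x , + y) (T a b)

  bar stem : Polyomino
  bar  = map (λ i → (+ suc i , + 1)) (upTo (suc (2 * a)))
  stem = map (λ j → (+ suc a , + (2 + j))) (upTo b)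

  size-T : size (T a b) ≡ suc (2 * a) + b
  size-T = begin
    size (T a b)                    ≡⟨ length-++ bar ⟩
    length bar + length stem        ≡⟨ cong₂ _+_ (trans (length-map _ (upTo (suc (2 * a)))) (length-upTo _))
                                                 (trans (length-map _ (upTo b)) (length-upTo b)) ⟩
    suc (2 * a) + b                 ∎
    where open ≡-Reasoning

  ∈-T⁻ : ∀ {c} → c ∈ T a b →
         ∃₂ λ x y → c ≡ (+ x , + y) × (1 ≤ x × x ≤ suc (2 * a)) × (1 ≤ y × y ≤ suc b)
  ∈-T⁻ c∈T with ∈-++⁻ bar c∈T
  ... | inj₁ c∈bar with ∈-map⁻ _ c∈bar
  ...   | i , i∈ , refl = suc i , 1 , refl , (s≤s z≤n , ∈-upTo⁻ i∈) , (s≤s z≤n , s≤s z≤n)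
  ∈-T⁻ c∈T | inj₂ c∈stem with ∈-map⁻ _ c∈stem
  ...   | j , j∈ , refl = suc a , 2 + j , refl , (s≤s z≤n , s≤s (m≤m+n a _)) , (s≤s z≤n , s≤s (∈-upTo⁻ j∈))

  ∈-Copy⁻ : ∀ {dx dy c} → c ∈ Copy dx dy →
            ∃₂ λ x y → c ≡ (+ (x + dx) , + (y + dy)) × (1 ≤ x × x ≤ suc (2 * a)) × (1 ≤ y × y ≤ suc b)
  ∈-Copy⁻ c∈Copy with ∈-map⁻ _ c∈Copy
  ... | _ , c∈T , refl with ∈-T⁻ c∈T
  ...   | x , y , refl , bounds = x , y , refl , bounds

  ∈-Copy⁺ : ∀ x y {u v} → (+ u , + v) ∈ T a b → (+ (u + x) , + (v + y)) ∈ Copy x y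
  ∈-Copy⁺ x y = ∈-map⁺ _

  corner∈T : (+ 1 , + 1) ∈ T a b
  corner∈T = ∈-++⁺ˡ {ys = stem} (∈-map⁺ _ (∈-upTo⁺ {i = 0} z<s))

  bar∈Copy : ∀ x y {i} → i ≤ 2 * a → (+ (suc i + x) , + suc y) ∈ Copy x y
  bar∈Copy x y i≤2a = ∈-Copy⁺ x y (∈-++⁺ˡ (∈-map⁺ _ (∈-upTo⁺ (s≤s i≤2a))))

  column∈Copy : ∀ x y {j} → j ≤ b → (+ (suc a + x) , + suc (j + y)) ∈ Copy x y
  column∈Copy x y {zero}  _   = bar∈Copy x y (m≤m+n a _)
  column∈Copy x y {suc j} j<b = ∈-Copy⁺ x y (∈-++⁺ʳ bar (∈-map⁺ _ (∈-upTo⁺ j<b)))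

  row∈Copy : ∀ x y {X} → suc x ≤ X → X ≤ suc (2 * a) + x → (+ X , + suc y) ∈ Copy x y
  row∈Copy x y x<X X≤ with m≤n⇒∃[o]m+o≡n x<X
  ... | i , refl = subst (λ X → (+ X , + suc y) ∈ Copy x y) (cong suc (+-comm i x))
                     (bar∈Copy x y (+-cancelˡ-≤ (suc x) i (2 * a)
                        (subst (suc x + i ≤_) (cong suc (+-comm (2 * a) x)) X≤)))

  shared⇒rows-Within : ∀ {x y x′ y′ c} → c ∈ Copy x y → c ∈ Copy x′ y′ → Within b y y′
  shared⇒rows-Within c∈ c∈′ with ∈-Copy⁻ c∈ | ∈-Copy⁻ c∈′
  ... | _ , r , refl , _ , (1≤r , r≤1+b) | _ , r′ , eq , _ , (1≤r′ , r′≤1+b) =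
    row-offset-≤ b rows 1≤r r′≤1+b , row-offset-≤ b (sym rows) 1≤r′ r≤1+b
    where rows = +-injective (,-injectiveʳ eq)

  column-meets-row : ∀ {x y x′ y′} → Within a x x′ → y ≤ y′ → y′ ≤ y + b →
                     ∃ λ c → c ∈ Copy x y × c ∈ Copy x′ y′
  column-meets-row {x} {y} {x′} (x≤x′+a , x′≤x+a) y≤y′ y′≤y+b with m≤n⇒∃[o]m+o≡n y≤y′
  ... | j , refl = _ , column∈Copy x y (+-cancelˡ-≤ y j b y′≤y+b) ,
    subst (λ Y → (+ (suc a + x) , + suc Y) ∈ Copy x′ (y + j)) (+-comm y j)
      (row∈Copy x′ (y + j) (s≤s (subst (x′ ≤_) (+-comm x a) x′≤x+a))
                           (s≤s (subst (a + x ≤_) (a+[x′+a]≡2a+x′ a x′) (+-monoʳ-≤ a x≤x′+a))))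
    where
    a+[x′+a]≡2a+x′ : ∀ a x′ → a + (x′ + a) ≡ 2 * a + x′
    a+[x′+a]≡2a+x′ = solve-∀

  Within⇒shared : ∀ {x y x′ y′} → Within a x x′ → Within b y y′ →
                  ∃ λ c → c ∈ Copy x y × c ∈ Copy x′ y′
  Within⇒shared wx (y≤y′+b , y′≤y+b) with ≤-total _ _
  ... | inj₁ y≤y′ = column-meets-row wx y≤y′ y′≤y+b
  ... | inj₂ y′≤y = Product.map₂ swap (column-meets-row (Within-sym wx) y′≤y y≤y′+b)

  Copy-inBoard : ∀ {x y} → x ≤ b → y ≤ 2 * a → All (InBoard (size (T a b))) (Copy x y)
  Copy-inBoard {x} {y} x≤b y≤2a = All.tabulate inBoard
    where
    inBoard : ∀ {c} → c ∈ Copy x y → InBoard (size (T a b)) c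
    inBoard c∈ with ∈-Copy⁻ c∈
    ... | u , v , refl , (1≤u , u≤1+2a) , (1≤v , v≤1+b) rewrite size-T =
      (+≤+ (≤-trans 1≤u (m≤m+n u x)) , +≤+ (+-mono-≤ u≤1+2a x≤b)) ,
      (+≤+ (≤-trans 1≤v (m≤m+n v y)) ,
       +≤+ (subst (v + y ≤_) (cong suc (+-comm b (2 * a))) (+-mono-≤ v≤1+b y≤2a)))

  inBoard⇒Copy : ∀ s → All (InBoard (size (T a b))) (shift s (T a b)) →
                 ∃₂ λ x y → s ≡ (+ x , + y) × x ≤ b × y ≤ 2 * a
  inBoard⇒Copy (sx , sy) inBoard
    with corner ← All.lookup inBoard (∈-map⁺ _ corner∈T)
    with 1≤1+i⇒ℕ sx (proj₁ (proj₁ corner)) | 1≤1+i⇒ℕ sy (proj₁ (proj₂ corner))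
  ... | x , refl | y , refl = x , y , refl ,
    +-cancelˡ-≤ (suc (2 * a)) x b (subst (suc (2 * a) + x ≤_) size-T (drop‿+≤+ right-end)) ,
    +-cancelˡ-≤ b y (2 * a)
      (s≤s⁻¹ (subst (suc (b + y) ≤_) (trans size-T (cong suc (+-comm (2 * a) b))) (drop‿+≤+ top-end)))
    where
    right-end = proj₂ (proj₁ (All.lookup inBoard (bar∈Copy x y ≤-refl)))
    top-end   = proj₂ (proj₂ (All.lookup inBoard (column∈Copy x y ≤-refl)))

  cp-lower-bound : ∀ L → FixedPacking (T a b) L → ⌈ suc (2 * a) / suc (2 * b) ⌉ ≤ length L
  cp-lower-bound L ((inBoard-L , disjoint-L) , maximal) =
    m<k*d⇒⌈1+m/d⌉≤k (subst (λ k → suc (2 * a) ≤ k * suc (2 * b)) (length-map rowOf L)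
                       (covering-bound b (map rowOf L) (suc (2 * a)) rows-cover))
    where
    rowOf : ℤ × ℤ → ℕ
    rowOf s = ℤ.∣ proj₂ s ∣

    -- a row offset i missed by all copies would allow adding the copy at (0, i)
    rows-cover : ∀ i → i < suc (2 * a) → Any (Within b i) (map rowOf L)
    rows-cover i i<1+2a with Any.any? (λ s → within? b i (rowOf s)) L
    ... | yes near = Any-map⁺ near
    ... | no far = ⊥-elim (maximal (+ 0 , + i)
            ((Copy-inBoard z≤n (s≤s⁻¹ i<1+2a) ∷ inBoard-L) , (All.tabulate disjoint ∷ disjoint-L)))
      where
      disjoint : ∀ {s} → s ∈ L → Disjoint (Copy 0 i) (shift s (T a b))
      disjoint s∈L c∈ c∈′ with inBoard⇒Copy _ (All.lookup inBoard-L s∈L)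
      ... | _ , _ , refl , _ = All.lookup (¬Any⇒All¬ L far) s∈L (shared⇒rows-Within c∈ c∈′)

  module _ (b≤2a : b ≤ 2 * a) where

    private
      d = suc (2 * b)
      q = 2 * a / d

    column : ℕ
    column = b ∸ a

    row : ℕ → ℕ
    row j = (b + j * d) ⊓ (2 * a)

    offset : ℕ → ℤ × ℤ
    offset j = (+ column , + row j)

    packing : List (ℤ × ℤ)
    packing = applyUpTo offset (suc q)

    Within-column : ∀ {x} → x ≤ b → Within a x column
    Within-column {x} x≤b =
      ≤-trans x≤b (subst (b ≤_) (+-comm a column) (m≤n+m∸n b a)) ,
      ≤-trans (m≤n+o⇒m∸n≤o b a (subst (b ≤_) (cong (λ k → a + k) (+-identityʳ a)) b≤2a)) (m≤n+m a x)

    rows-separated : ∀ {i j} → i < j → j ≤ q → row i + b < row j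
    rows-separated {i} {j} i<j j≤q =
      ≤-trans (s≤s (+-monoˡ-≤ b (m⊓n≤m _ _)))
              (⊓-glb (≤-trans gap (m≤n+m (j * d) b))
                     (≤-trans gap (≤-trans (*-monoˡ-≤ d j≤q) (m/n*n≤m (2 * a) d))))
      where
      1+[b+i*d+b]≡[1+i]*d : ∀ b i → suc (b + i * suc (2 * b) + b) ≡ suc i * suc (2 * b)
      1+[b+i*d+b]≡[1+i]*d = solve-∀

      gap : suc (b + i * d + b) ≤ j * d
      gap = ≤-trans (≤-reflexive (1+[b+i*d+b]≡[1+i]*d b i)) (*-monoˡ-≤ d i<j)

    Within-row : ∀ {y} → y ≤ 2 * a → Within b y (row (y / d))
    Within-row {y} y≤2a =
      subst (y ≤_) (sym (+-distribʳ-⊓ b (b + j * d) (2 * a))) (⊓-glb y≤b+j*d+b (m≤n⇒m≤n+o b y≤2a)) ,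
      ≤-trans (m⊓n≤m _ _) (subst (b + j * d ≤_) (+-comm b y) (+-monoʳ-≤ b (m/n*n≤m y d)))
      where
      j = y / d

      2b+x≡b+x+b : ∀ b x → 2 * b + x ≡ b + x + b
      2b+x≡b+x+b = solve-∀

      y≤b+j*d+b : y ≤ b + j * d + b
      y≤b+j*d+b = begin
        y                 ≡⟨ m≡m%n+[m/n]*n y d ⟩
        y ℕ.% d + j * d   ≤⟨ +-monoˡ-≤ (j * d) (s≤s⁻¹ (m%n<n y d)) ⟩
        2 * b + j * d     ≡⟨ 2b+x≡b+x+b b (j * d) ⟩
        b + j * d + b     ∎
        where open ≤-Reasoning

    packing-valid : ValidArrangement (size (T a b)) (T a b) packing
    packing-valid =
      All.tabulate inBoard ,
      applyUpTo⁺₁ offset (suc q) (λ i<j j<1+q c∈ c∈′ →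
        <⇒≱ (rows-separated i<j (s≤s⁻¹ j<1+q)) (proj₂ (shared⇒rows-Within c∈ c∈′)))
      where
      inBoard : ∀ {s} → s ∈ packing → All (InBoard (size (T a b))) (shift s (T a b))
      inBoard s∈ with ∈-applyUpTo⁻ offset s∈
      ... | _ , _ , refl = Copy-inBoard (m∸n≤m b a) (m⊓n≤n _ _)

    packing-maximal : ∀ s → ¬ ValidArrangement (size (T a b)) (T a b) (s ∷ packing)
    packing-maximal s ((inBoard ∷ _) , (disjoint ∷ _)) with inBoard⇒Copy s inBoard
    ... | x , y , refl , x≤b , y≤2a with Within⇒shared (Within-column x≤b) (Within-row y≤2a)
    ... | _ , c∈ , c∈′ = All.lookup disjoint (∈-applyUpTo⁺ offset (s≤s (/-monoˡ-≤ d y≤2a))) c∈ c∈′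

    length-packing : length packing ≡ ⌈ suc (2 * a) / suc (2 * b) ⌉
    length-packing = trans (length-applyUpTo offset (suc q)) (sym (⌈1+m/d⌉≡1+⌊m/d⌋ (2 * a) d))

theorem3p14 : (a b : ℕ) → 0 < a → 0 < b → b ≤ 2 * a →
    IsClumsyFixedPackingNumber (T a b) ⌈ suc (2 * a) / suc (2 * b) ⌉
theorem3p14 a b _ _ b≤2a =
  (packing a b b≤2a , (packing-valid a b b≤2a , packing-maximal a b b≤2a) , length-packing a b b≤2a) ,
  cp-lower-bound a b
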